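{- For each of the triplets $(e,12,e)$, $(e,12,13)$, $(e,12,23)$, $(e,13,12)$, $(e,23,e)$, $(e,23,13)$, $(e,23,23)$, $(e,123,e)$, $(e,123,13)$, $(e,123,23)$, the minimal terms of the TRIP-Stern tree lie on both the left-most and the right-most paths: for every $n\ge0$, the minimum $b_n=\min_{|v|=n}\min_i b_i(v)$ is attained as an entry of $(1,1,1)F_0^n$ and also as an entry of $(1,1,1)F_1^n$.
   Context: Let $A_0=\begin{pmatrix}0&0&1\\1&0&0\\0&1&1\end{pmatrix}$, $A_1=\begin{pmatrix}1&0&1\\0&1&0\\0&0&1\end{pmatrix}$. Elements of $S_3$ are identified with permutation matrices: $e=I$, $(12)=\begin{pmatrix}0&1&0\\1&0&0\\0&0&1\end{pmatrix}$, $(13)=\begin{pmatrix}0&0&1\\0&1&0\\1&0&0\end{pmatrix}$, $(23)=\begin{pmatrix}1&0&0\\0&0&1\\0&1&0\end{pmatrix}$, $(123)=\begin{pmatrix}0&1&0\\0&0&1\\1&0&0\end{pmatrix}$, $(132)=\begin{pmatrix}0&0&1\\1&0&0\\0&1&0\end{pmatrix}$. For $(\sigma,\tau_0,\tau_1)\in S_3^3$ put $F_0=\sigma A_0\tau_0$, $F_1=\sigma A_1\tau_1$. For $v=(i_1,\dots,i_n)\in\{0,1\}^n$ let $\triangle(v)=(1,1,1)F_{i_1}\cdots F_{i_n}=(b_1(v),b_2(v),b_3(v))$; level $n$ of the TRIP-Stern tree consists of the $\triangle(v)$ with $|v|=n$. -}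

module Defs where

open import Data.Nat using (ℕ; zero; suc; _+_; _*_; _⊓_)
open import Data.Fin using (Fin; zero; suc)
open import Data.Bool using (Bool; true; false)
open import Data.Vec using (Vec; []; _∷_)
open import Data.List using (List; []; _∷_)
open import Data.Product using (_×_; _,_)

Mat : Set
Mat = Fin 3 → Fin 3 → ℕ

Row : Set
Row = Fin 3 → ℕ

mat : ℕ → ℕ → ℕ → ℕ → ℕ → ℕ → ℕ → ℕ → ℕ → Mat
mat a b c d e f g h i zero zero = a
mat a b c d e f g h i zero (suc zero) = b
mat a b c d e f g h i zero (suc (suc zero)) = c
mat a b c d e f g h i (suc zero) zero = d
mat a b c d e f g h i (suc zero) (suc zero) = e
mat a b c d e f g h i (suc zero) (suc (suc zero)) = f
mat a b c d e f g h i (suc (suc zero)) zero = g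
mat a b c d e f g h i (suc (suc zero)) (suc zero) = h
mat a b c d e f g h i (suc (suc zero)) (suc (suc zero)) = i

sum3 : (Fin 3 → ℕ) → ℕ
sum3 f = f zero + f (suc zero) + f (suc (suc zero))

_⊗_ : Mat → Mat → Mat
(A ⊗ B) i j = sum3 (λ k → A i k * B k j)

_·_ : Row → Mat → Row
(r · A) j = sum3 (λ k → r k * A k j)

infixl 7 _⊗_ _·_

A₀ A₁ : Mat
A₀ = mat 0 0 1
         1 0 0
         0 1 1
A₁ = mat 1 0 1
         0 1 0
         0 0 1

data S3 : Set where
  e p12 p13 p23 p123 p132 : S3

pm : S3 → Mat
pm e    = mat 1 0 0  0 1 0  0 0 1
pm p12  = mat 0 1 0  1 0 0  0 0 1
pm p13  = mat 0 0 1  0 1 0  1 0 0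
pm p23  = mat 1 0 0  0 0 1  0 1 0
pm p123 = mat 0 1 0  0 0 1  1 0 0
pm p132 = mat 0 0 1  1 0 0  0 1 0

Triplet : Set
Triplet = S3 × S3 × S3

F₀ F₁ : Triplet → Mat
F₀ (σ , τ₀ , τ₁) = pm σ ⊗ A₀ ⊗ pm τ₀
F₁ (σ , τ₀ , τ₁) = pm σ ⊗ A₁ ⊗ pm τ₁

F : Triplet → Bool → Mat
F t false = F₀ t
F t true  = F₁ t

ones : Row
ones _ = 1

-- △(v) = (1,1,1) F_{i₁} ⋯ F_{iₙ}   (false = 0, true = 1)
-- computed as ((…((1,1,1) F_{i₁}) F_{i₂}) …) F_{iₙ}
triAcc : Triplet → Row → {n : ℕ} → Vec Bool n → Row
triAcc t r [] = r
triAcc t r (b ∷ v) = triAcc t (r · F t b) v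

tri : Triplet → {n : ℕ} → Vec Bool n → Row
tri t v = triAcc t ones v

min3 : Row → ℕ
min3 r = r zero ⊓ r (suc zero) ⊓ r (suc (suc zero))

minOver : (n : ℕ) → (Vec Bool n → ℕ) → ℕ
minOver zero f = f []
minOver (suc n) f = minOver n (λ v → f (false ∷ v)) ⊓ minOver n (λ v → f (true ∷ v))

bmin : Triplet → ℕ → ℕ
bmin t n = minOver n (λ v → min3 (tri t v))

powRow : Mat → ℕ → Row
powRow M zero = ones
powRow M (suc n) = powRow M n · M

triplets : List Triplet
triplets =
  (e , p12 , e) ∷ (e , p12 , p13) ∷ (e , p12 , p23) ∷ (e , p13 , p12) ∷
  (e , p23 , e) ∷ (e , p23 , p13) ∷ (e , p23 , p23) ∷ (e , p123 , e) ∷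
  (e , p123 , p13) ∷ (e , p123 , p23) ∷ []

-- Both F₀ and F₁ have no zero column, so every entry of every △(v) is at least 1.
-- Each F_b also has columns i, i' (possibly equal) with column i = e_{i'} and
-- column i' = e_i; multiplying by F_b then swaps the entries i and i' of a row,
-- so these entries of (1,1,1) F_bⁿ stay equal to 1.  Hence bₙ = 1, and it is
-- attained on both extreme paths.  For the ten triplets both properties of F₀
-- and F₁ are checked by evaluating a decision procedure.
module Submission where

open import Defs
open import Data.Nat using (ℕ; zero; suc; _+_; _*_; _≤_; _≤?_; _≟_)
open import Data.Nat.Properties
open import Data.Nat.Solver using (module +-*-Solver)
open +-*-Solver using (solve; _:+_; _:*_; con; _:=_)
open import Data.Fin using (Fin; zero; suc)
open import Data.Fin.Properties using (all?; any?)
open import Data.Bool using (Bool; true; false)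
open import Data.Vec using (Vec; []; _∷_; replicate)
open import Data.Product using (_×_; ∃; _,_; proj₁; proj₂)
open import Data.List.Membership.Propositional using (_∈_)
open import Data.List.Relation.Unary.All as All using (All)
open import Relation.Nullary using (Dec)
open import Relation.Nullary.Decidable using (_×-dec_; map′; toWitness)
open import Relation.Binary.PropositionalEquality

δ : Fin 3 → Fin 3 → ℕ
δ zero             zero             = 1
δ (suc zero)       (suc zero)       = 1
δ (suc (suc zero)) (suc (suc zero)) = 1
δ _                _                = 0

UnitColumn : Mat → Fin 3 → Fin 3 → Set
UnitColumn M j k = ∀ l → M l j ≡ δ k l

NoZeroColumn : Mat → Set
NoZeroColumn M = ∀ j → 1 ≤ sum3 (λ k → M k j)

Positive : Row → Set
Positive r = ∀ i → 1 ≤ r i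

SwapsUnitColumns : Mat → Fin 3 → Fin 3 → Set
SwapsUnitColumns M i i' = UnitColumn M i i' × UnitColumn M i' i

sum3-δ : (r : Row) (k : Fin 3) → sum3 (λ l → r l * δ k l) ≡ r k
sum3-δ r zero             = solve 3 (λ a b c → a :* con 1 :+ b :* con 0 :+ c :* con 0 := a) refl
                              (r zero) (r (suc zero)) (r (suc (suc zero)))
sum3-δ r (suc zero)       = solve 3 (λ a b c → a :* con 0 :+ b :* con 1 :+ c :* con 0 := b) refl
                              (r zero) (r (suc zero)) (r (suc (suc zero)))
sum3-δ r (suc (suc zero)) = solve 3 (λ a b c → a :* con 0 :+ b :* con 0 :+ c :* con 1 := c) refl
                              (r zero) (r (suc zero)) (r (suc (suc zero)))

·-unitColumn : ∀ M j k → UnitColumn M j k → (r : Row) → (r · M) j ≡ r k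
·-unitColumn M j k u r = begin
  sum3 (λ l → r l * M l j)
    ≡⟨ cong₂ _+_ (cong₂ _+_ (cong (r zero *_) (u zero)) (cong (r (suc zero) *_) (u (suc zero))))
                 (cong (r (suc (suc zero)) *_) (u (suc (suc zero)))) ⟩
  sum3 (λ l → r l * δ k l)
    ≡⟨ sum3-δ r k ⟩
  r k ∎
  where open ≡-Reasoning

·-positive : ∀ {M} → NoZeroColumn M → ∀ {r} → Positive r → Positive (r · M)
·-positive {M} noZero {r} pos j = ≤-trans (noZero j)
  (+-mono-≤ (+-mono-≤ (term zero) (term (suc zero))) (term (suc (suc zero))))
  where
  term : ∀ k → M k j ≤ r k * M k j
  term k = subst (_≤ r k * M k j) (*-identityˡ (M k j)) (*-monoˡ-≤ (M k j) (pos k))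

powRow-swapsUnitColumns : ∀ M i i' → SwapsUnitColumns M i i' →
  ∀ n → powRow M n i ≡ 1 × powRow M n i' ≡ 1
powRow-swapsUnitColumns M i i' _ zero = refl , refl
powRow-swapsUnitColumns M i i' (u , u') (suc n) =
  let (ri , ri') = powRow-swapsUnitColumns M i i' (u , u') n in
  trans (·-unitColumn M i i' u (powRow M n)) ri' , trans (·-unitColumn M i' i u' (powRow M n)) ri

min3-≤ : (r : Row) (i : Fin 3) → min3 r ≤ r i
min3-≤ r zero             = ≤-trans (m⊓n≤m _ _) (m⊓n≤m _ _)
min3-≤ r (suc zero)       = ≤-trans (m⊓n≤m _ _) (m⊓n≤n _ _)
min3-≤ r (suc (suc zero)) = m⊓n≤n _ _

min3-glb : ∀ {m} (r : Row) → (∀ i → m ≤ r i) → m ≤ min3 r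
min3-glb r h = ⊓-glb (⊓-glb (h zero) (h (suc zero))) (h (suc (suc zero)))

minOver-≤ : ∀ n (f : Vec Bool n → ℕ) (v : Vec Bool n) → minOver n f ≤ f v
minOver-≤ zero    f []          = ≤-refl
minOver-≤ (suc n) f (false ∷ v) = ≤-trans (m⊓n≤m _ _) (minOver-≤ n _ v)
minOver-≤ (suc n) f (true ∷ v)  = ≤-trans (m⊓n≤n _ _) (minOver-≤ n _ v)

minOver-glb : ∀ {m} n (f : Vec Bool n → ℕ) → (∀ v → m ≤ f v) → m ≤ minOver n f
minOver-glb zero    f h = h []
minOver-glb (suc n) f h = ⊓-glb (minOver-glb n _ (λ v → h (false ∷ v)))
                                (minOver-glb n _ (λ v → h (true ∷ v)))

triAcc-positive : ∀ t → (∀ b → NoZeroColumn (F t b)) →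
  ∀ {n} (v : Vec Bool n) {r} → Positive r → Positive (triAcc t r v)
triAcc-positive t noZero []      pos = pos
triAcc-positive t noZero (b ∷ v) pos = triAcc-positive t noZero v (·-positive {F t b} (noZero b) pos)

triAcc-replicate : ∀ t b n k →
  triAcc t (powRow (F t b) k) (replicate n b) ≡ powRow (F t b) (n + k)
triAcc-replicate t b zero    k = refl
triAcc-replicate t b (suc n) k rewrite triAcc-replicate t b n (suc k) | +-suc n k = refl

tri-replicate : ∀ t b n → tri t (replicate n b) ≡ powRow (F t b) n
tri-replicate t b n = trans (triAcc-replicate t b n 0) (cong (powRow (F t b)) (+-identityʳ n))

bmin-positive : ∀ t → (∀ b → NoZeroColumn (F t b)) → ∀ n → 1 ≤ bmin t n
bmin-positive t noZero n =
  minOver-glb n _ (λ v → min3-glb (tri t v) (triAcc-positive t noZero v {ones} (λ _ → ≤-refl)))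

bmin≤powRow : ∀ t b n (i : Fin 3) → bmin t n ≤ powRow (F t b) n i
bmin≤powRow t b n i = begin
  bmin t n                           ≤⟨ minOver-≤ n _ (replicate n b) ⟩
  min3 (tri t (replicate n b))       ≤⟨ min3-≤ (tri t (replicate n b)) i ⟩
  tri t (replicate n b) i            ≡⟨ cong (λ r → r i) (tri-replicate t b n) ⟩
  powRow (F t b) n i                 ∎
  where open ≤-Reasoning

Admissible : Mat → Set
Admissible M = NoZeroColumn M × ∃ λ i → ∃ λ i' → SwapsUnitColumns M i i'

powRow-attains-bmin : ∀ {t} → (∀ b → Admissible (F t b)) → ∀ b n → ∃ λ i → powRow (F t b) n i ≡ bmin t n
powRow-attains-bmin {t} adm b n with proj₂ (adm b)
... | i , i' , swaps = i , trans powRow≡1 (sym bmin≡1)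
  where
  powRow≡1 : powRow (F t b) n i ≡ 1
  powRow≡1 = proj₁ (powRow-swapsUnitColumns (F t b) i i' swaps n)
  bmin≡1 : bmin t n ≡ 1
  bmin≡1 = ≤-antisym (≤-trans (bmin≤powRow t b n i) (≤-reflexive powRow≡1))
                     (bmin-positive t (λ b′ → proj₁ (adm b′)) n)

admissible? : ∀ M → Dec (Admissible M)
admissible? M = all? (λ j → 1 ≤? sum3 (λ k → M k j))
         ×-dec any? (λ i → any? (λ i' → unitColumn? i i' ×-dec unitColumn? i' i))
  where
  unitColumn? : ∀ j k → Dec (UnitColumn M j k)
  unitColumn? j k = all? (λ l → M l j ≟ δ k l)

∀-Bool? : {P : Bool → Set} → (∀ b → Dec (P b)) → Dec (∀ b → P b)
∀-Bool? P? = map′ (λ { (p , q) false → p ; (p , q) true → q }) (λ h → h false , h true)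
                  (P? false ×-dec P? true)

triplets-admissible : All (λ t → ∀ b → Admissible (F t b)) triplets
triplets-admissible =
  toWitness {a? = All.all? (λ t → ∀-Bool? (λ b → admissible? (F t b))) triplets} _

theorem18 : (t : Triplet) → t ∈ triplets → (n : ℕ) →
    (∃ λ (i : Fin 3) → powRow (F₀ t) n i ≡ bmin t n) ×
    (∃ λ (j : Fin 3) → powRow (F₁ t) n j ≡ bmin t n)
theorem18 t t∈triplets n = powRow-attains-bmin adm false n , powRow-attains-bmin adm true n
  where
  adm : ∀ b → Admissible (F t b)
  adm = All.lookup triplets-admissible t∈triplets
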